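{- Let $f:\mathcal{G}\to\mathbb{R}$, let $\Delta>0$, and let $\hat f:\mathcal{G}\to\mathbb{R}$ be $\Delta$-Lipschitz. Let $S_{\hat f}=\{G : \hat f(G)=f(G)\}$ and let $S'_{\hat f}$ be the largest monotone subset of $S_{\hat f}$. Then $S'_{\hat f}\subseteq\{G : DS_f(G)\le\Delta\}$.
   Context: $\mathcal{G}$ is the set of all finite undirected unweighted graphs. A set of graphs is monotone if whenever it contains $G$ it contains every induced subgraph of $G$. $H\preceq G$ means $H$ is an induced subgraph of $G$. Two graphs are node-neighbors if one is obtained from the other by deleting one vertex with its incident edges. $DS_f(G)=\max\{|f(H')-f(H)|: H\preceq H'\preceq G,\ H,H' \text{ node-neighbors}\}$. The node-distance $d(G,G')$ is the minimum number of vertex deletions (with incident edges) or vertex insertions (with arbitrary incident edges) transforming $G$ into $G'$; $\hat f$ is $\Delta$-Lipschitz if $|\hat f(G)-\hat f(G')|\le\Delta\,d(G,G')$ for all $G,G'$. -}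

module Defs where

open import Data.Nat using (ℕ; zero; suc)
open import Data.Fin using (Fin)
open import Data.Bool using (Bool; false)
open import Data.Product using (Σ; _×_; ∃)
open import Data.Sum using (_⊎_)
open import Function.Definitions using (Injective)
open import Relation.Binary.PropositionalEquality using (_≡_; _≢_)
open import Relation.Binary.Structures using (IsTotalOrder)
open import Algebra.Structures using (IsAbelianGroup)

-- The paper uses ℝ; agda-stdlib has no reals, so we
-- quantify over an arbitrary totally ordered abelian group (ℝ with +,
-- 0, -, ≤ is one).  Only this structure of ℝ is used in the statement.

record OrderedAbelianGroup : Set₁ where
  field
    Carrier        : Set
    _+_            : Carrier → Carrier → Carrier
    0#             : Carrier
    -_             : Carrier → Carrier
    _≤_            : Carrier → Carrier → Set
    isAbelianGroup : IsAbelianGroup _≡_ _+_ 0# -_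
    isTotalOrder   : IsTotalOrder _≡_ _≤_
    +-monoˡ-≤      : ∀ {x y} z → x ≤ y → (x + z) ≤ (y + z)

  infixl 6 _+_ _-_
  _-_ : Carrier → Carrier → Carrier
  x - y = x + (- y)

  _<_ : Carrier → Carrier → Set
  x < y = x ≤ y × x ≢ y

  ∣_∣≤_ : Carrier → Carrier → Set
  ∣ x ∣≤ c = (x ≤ c) × ((- x) ≤ c)

  _·_ : ℕ → Carrier → Carrier
  zero  · x = 0#
  suc k · x = x + (k · x)

record Graph : Set where
  field
    size  : ℕ
    adj   : Fin size → Fin size → Bool
    sym   : ∀ i j → adj i j ≡ adj j i
    irref : ∀ i → adj i i ≡ false
open Graph public

-- H ≼ G : H is an induced subgraph of G (up to isomorphism):
-- an injective vertex map preserving adjacency and non-adjacency.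
_≼_ : Graph → Graph → Set
H ≼ G = Σ (Fin (size H) → Fin (size G)) λ φ →
          Injective _≡_ _≡_ φ × (∀ i j → adj H i j ≡ adj G (φ i) (φ j))

DeleteOne : Graph → Graph → Set
DeleteOne H H' = (size H' ≡ suc (size H)) × (H ≼ H')

NodeNeighbors : Graph → Graph → Set
NodeNeighbors G G' = DeleteOne G G' ⊎ DeleteOne G' G

-- G can be transformed into G' by exactly k single vertex deletions /
-- insertions.  d(G,G') is the least such k.
data Reach : ℕ → Graph → Graph → Set where
  here : ∀ {G} → Reach zero G G
  step : ∀ {k G G' G''} → NodeNeighbors G G' → Reach k G' G'' → Reach (suc k) G G''

module _ (R : OrderedAbelianGroup) where
  open OrderedAbelianGroup R

  -- |f̂ G - f̂ G'| ≤ Δ · d(G,G') for all G, G'.  Since d is the minimum k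
  -- with Reach k G G', this is equivalent to the bound for every such k.
  Lipschitz : Carrier → (Graph → Carrier) → Set
  Lipschitz Δ g = ∀ k G G' → Reach k G G' → ∣ g G - g G' ∣≤ (k · Δ)

  S : (Graph → Carrier) → (Graph → Carrier) → Graph → Set
  S f f̂ G = f̂ G ≡ f G

  -- DS_f(G) ≤ Δ : the maximum over node-neighbor pairs H ≼ H' ≼ G is ≤ Δ.
  DS≤ : (Graph → Carrier) → Graph → Carrier → Set
  DS≤ f G Δ = ∀ H H' → DeleteOne H H' → H' ≼ G → ∣ f H' - f H ∣≤ Δ

Monotone : (Graph → Set) → Set
Monotone P = ∀ G H → P G → H ≼ G → P H

LargestMonotoneSubset : (Graph → Set) → Graph → Set
LargestMonotoneSubset P G = ∀ H → H ≼ G → P H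

{-# OPTIONS --safe #-}
module Submission where

open import Defs
open import Data.Product using (_,_; proj₂)
open import Data.Sum using (inj₂)
open import Function using (_∘_)
open import Relation.Binary.PropositionalEquality using (_≡_; trans; subst; subst₂)
open import Algebra.Structures using (IsAbelianGroup)

-- Every induced subgraph H ≼ H' ≼ G of a graph in the largest monotone subset of S
-- lies in S, so f and f̂ agree on H and H', and f inherits f̂'s bound Δ · d(H, H') = Δ.

≼-trans : ∀ {A B C} → A ≼ B → B ≼ C → A ≼ C
≼-trans (φ , φ-inj , φ-adj) (ψ , ψ-inj , ψ-adj) =
  ψ ∘ φ , φ-inj ∘ ψ-inj , λ i j → trans (φ-adj i j) (ψ-adj (φ i) (φ j))

largestMonotoneSubset-closed : ∀ {P G H} → LargestMonotoneSubset P G → H ≼ G →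
                               LargestMonotoneSubset P H
largestMonotoneSubset-closed {G = G} {H} inP H≼G K K≼H = inP K (≼-trans {K} {H} {G} K≼H H≼G)

module _ (R : OrderedAbelianGroup) where
  open OrderedAbelianGroup R

  1·-identity : ∀ x → 1 · x ≡ x
  1·-identity = IsAbelianGroup.identityʳ isAbelianGroup

  Lipschitz⇒deleteOne-bound : ∀ {Δ g H H'} → Lipschitz R Δ g → DeleteOne H H' →
                              ∣ g H' - g H ∣≤ Δ
  Lipschitz⇒deleteOne-bound {Δ} {g} {H} {H'} lip d =
    subst (∣ g H' - g H ∣≤_) (1·-identity Δ) (lip 1 H' H (step (inj₂ d) here))

lemmaA3 : (R : OrderedAbelianGroup) → let open OrderedAbelianGroup R in
    (f f̂ : Graph → Carrier) (Δ : Carrier) → 0# < Δ → Lipschitz R Δ f̂ →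
    ∀ G → LargestMonotoneSubset (S R f f̂) G → DS≤ R f G Δ
lemmaA3 R f f̂ Δ _ lip G inS′ H H' d H'≼G =
  subst₂ (λ x y → ∣ x - y ∣≤ Δ) f̂H'≡fH' f̂H≡fH (Lipschitz⇒deleteOne-bound R lip d)
  where
  open OrderedAbelianGroup R
  f̂H'≡fH' : f̂ H' ≡ f H'
  f̂H'≡fH' = inS′ H' H'≼G
  f̂H≡fH : f̂ H ≡ f H
  f̂H≡fH = largestMonotoneSubset-closed {G = G} {H'} inS′ H'≼G H (proj₂ d)
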